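{- For positive integers $m,n,r$, \begin{align*} \sum_{a=1}^{m-r}\sum_{b=1}^{n-r}\binom{m+n-a+b-1}{m-r-a}\binom{m+n+a-b-1}{n-r-b} &=\frac{mn}{2(m+n)}\binom{m+n}{m}^2-\frac{r}{2}\binom{2m+2n}{2m}+\frac{r}{2}\binom{m+n}{m}^2\\ &\quad+\sum_{k=1}^{r-1}(r-k)\binom{m+n}{m-k}\binom{m+n}{n-k}. \end{align*}
   Context: Binomial coefficients $\binom{N}{k}$ are $0$ when $k<0$ or $k>N\ge0$. A sum whose upper limit is smaller than its lower limit is empty and equals $0$. -}

module Defs where

open import Data.Nat using (ℕ; zero; suc)
import Data.Nat as ℕ
open import Data.Nat.Combinatorics using (_C_)
open import Data.Integer using (ℤ; +_; -[1+_]; _-_)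
open import Data.Rational using (ℚ; 0ℚ; _+_)
import Data.Rational as ℚ

-- Binomial coefficient with natural upper index N and integer lower index k:
-- zero when k < 0 (and N C k = 0 for k > N by the library definition).
binom : ℕ → ℤ → ℕ
binom N (+ k)    = N C k
binom N -[1+ _ ] = 0

-- Σ_{i = 1}^{u} f i for an integer upper limit u; empty (= 0) when u < 1.
sumFrom1 : ℤ → (ℕ → ℚ) → ℚ
sumFrom1 (+ u)    f = go u
  where
  go : ℕ → ℚ
  go zero    = 0ℚ
  go (suc j) = go j + f (suc j)
sumFrom1 -[1+ _ ] f = 0ℚ

⟦_⟧ : ℕ → ℚ
⟦ n ⟧ = ℚ._/_ (+ n) 1

open import Data.Nat using (NonZero)
divℕ : (p q : ℕ) → .{{NonZero q}} → ℚ
divℕ p q = ℚ._/_ (+ p) q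

nz2mn : ∀ m n → .{{NonZero m}} → NonZero (2 ℕ.* (m ℕ.+ n))
nz2mn (suc m) n = _

{-# OPTIONS --safe #-}
-- Write N = m + n and tᵢ = C(N, m − 1 − i) C(N, n − 1 − i). Removing the first row and column
-- from the double sum at r leaves the double sum at r + 1, and by Vandermonde-type convolutions
-- the removed hook sums to ∑_{i ≥ r} tᵢ. Telescoping in r turns the left-hand side into
-- ∑_{i ≥ r} (i − r + 1) tᵢ = ∑ᵢ (i + 1) tᵢ − r ∑ᵢ tᵢ + ∑_{k=1}^{r−1} (r − k) C(N, m − k) C(N, n − k).
-- Absorption gives 2N ∑ᵢ (i + 1) tᵢ = mn C(N, m)², and Vandermonde's identity gives
-- C(2N, 2m) = C(N, m)² + 2 ∑ᵢ tᵢ.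
module Submission where

open import Data.Nat using (ℕ; NonZero; zero; suc)
open import Data.Nat.Combinatorics using (_C_)
open import Relation.Binary.PropositionalEquality
open ≡-Reasoning

module BinomialIdentities where

  open import Data.Nat using (_+_; _*_; _∸_; _^_; _<_; _≤_; _≤?_; s≤s; z≤n)
  open import Data.Nat.Properties
  open import Algebra.Properties.CommutativeSemigroup +-commutativeSemigroup using ()
    renaming (interchange to +-interchange)
  open import Data.Nat.Combinatorics using (nCk+nC[k+1]≡[n+1]C[k+1]; nCk≡nC[n∸k])
  open import Data.Nat.Tactic.RingSolver using (solve-∀)
  open import Relation.Nullary using (yes; no)

  -- Pascal's rule holds definitionally here, unlike for the library's _C_ (defined via falling factorials).
  infix 8 _choose_
  _choose_ : ℕ → ℕ → ℕ
  n     choose zero  = 1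
  zero  choose suc k = 0
  suc n choose suc k = n choose k + n choose suc k

  choose≡C : ∀ n k → n choose k ≡ n C k
  choose≡C n       zero    = refl
  choose≡C zero    (suc k) = refl
  choose≡C (suc n) (suc k) =
    trans (cong₂ _+_ (choose≡C n k) (choose≡C n (suc k))) (nCk+nC[k+1]≡[n+1]C[k+1] n k)

  choose-< : ∀ {n k} → n < k → n choose k ≡ 0
  choose-< {zero}  {suc k} _         = refl
  choose-< {suc n} {suc k} (s≤s n<k) = cong₂ _+_ (choose-< n<k) (choose-< (m<n⇒m<1+n n<k))

  choose-self : ∀ n → n choose n ≡ 1
  choose-self zero    = refl
  choose-self (suc n) = cong₂ _+_ (choose-self n) (choose-< (n<1+n n))

  choose-sym : ∀ a b → (a + b) choose a ≡ (a + b) choose b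
  choose-sym a b = begin
    (a + b) choose a        ≡⟨ choose≡C (a + b) a ⟩
    (a + b) C a             ≡⟨ nCk≡nC[n∸k] (m≤m+n a b) ⟩
    (a + b) C (a + b ∸ a)   ≡⟨ cong ((a + b) C_) (m+n∸m≡n a b) ⟩
    (a + b) C b             ≡⟨ choose≡C (a + b) b ⟨
    (a + b) choose b        ∎

  choose-sym′ : ∀ {x} a b → x ≡ a + b → x choose a ≡ x choose b
  choose-sym′ a b refl = choose-sym a b

  -- x choose (a − t) for the integer a − t, hence zero when t > a.
  chooseDiff : ℕ → ℕ → ℕ → ℕ
  chooseDiff x a       zero    = x choose a
  chooseDiff x zero    (suc t) = 0
  chooseDiff x (suc a) (suc t) = chooseDiff x a t

  chooseDiff-shift : ∀ c x a t → chooseDiff x (c + a) (c + t) ≡ chooseDiff x a t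
  chooseDiff-shift zero    x a t = refl
  chooseDiff-shift (suc c) x a t = chooseDiff-shift c x a t

  chooseDiff-≤ : ∀ x {a t} → t ≤ a → chooseDiff x a t ≡ x choose (a ∸ t)
  chooseDiff-≤ x {a}     {zero}  _         = refl
  chooseDiff-≤ x {suc a} {suc t} (s≤s t≤a) = chooseDiff-≤ x t≤a

  choose-pascal : ∀ x k → suc x choose k ≡ chooseDiff x k 1 + x choose k
  choose-pascal x zero    = refl
  choose-pascal x (suc k) = refl

  choose-absorb : ∀ n k → k * (suc n choose k) ≡ suc n * chooseDiff n k 1
  choose-absorb zero    zero          = refl
  choose-absorb zero    (suc zero)    = refl
  choose-absorb zero    (suc (suc k)) = *-zeroʳ (suc (suc k))
  choose-absorb (suc n) zero          = sym (*-zeroʳ (suc (suc n)))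
  choose-absorb (suc n) (suc k)       = begin
      suc k * (suc n choose k + suc n choose suc k)
    ≡⟨ split k (suc n choose k) (suc n choose suc k) ⟩
      k * (suc n choose k) + suc n choose k + suc k * (suc n choose suc k)
    ≡⟨ cong₂ (λ u v → u + suc n choose k + v) (choose-absorb n k) (choose-absorb n (suc k)) ⟩
      suc n * P + suc n choose k + suc n * n choose k
    ≡⟨ cong (λ u → suc n * P + u + suc n * n choose k) (choose-pascal n k) ⟩
      suc n * P + (P + n choose k) + suc n * n choose k
    ≡⟨ merge n P (n choose k) ⟩
      suc (suc n) * (P + n choose k)
    ≡⟨ cong (suc (suc n) *_) (choose-pascal n k) ⟨
      suc (suc n) * (suc n choose k) ∎
    where
    P = chooseDiff n k 1
    split : ∀ k a b → suc k * (a + b) ≡ k * a + a + suc k * b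
    split = solve-∀
    merge : ∀ n a b → suc n * a + (a + b) + suc n * b ≡ suc (suc n) * (a + b)
    merge = solve-∀

  sumTo : ℕ → (ℕ → ℕ) → ℕ
  sumTo zero    f = 0
  sumTo (suc u) f = sumTo u f + f (suc u)

  sumTo-peel : ∀ u f → sumTo (suc u) f ≡ f 1 + sumTo u (λ k → f (suc k))
  sumTo-peel zero    f = +-comm 0 (f 1)
  sumTo-peel (suc u) f = trans (cong (_+ f (suc (suc u))) (sumTo-peel u f))
                               (+-assoc (f 1) (sumTo u (λ k → f (suc k))) (f (suc (suc u))))

  sumTo-cong : ∀ u {f g} → (∀ k → k < u → f (suc k) ≡ g (suc k)) → sumTo u f ≡ sumTo u g
  sumTo-cong zero    eq = refl
  sumTo-cong (suc u) eq = cong₂ _+_ (sumTo-cong u (λ k k<u → eq k (m<n⇒m<1+n k<u))) (eq u (n<1+n u))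

  sumTo-zero : ∀ u f → (∀ k → k < u → f (suc k) ≡ 0) → sumTo u f ≡ 0
  sumTo-zero zero    f eq = refl
  sumTo-zero (suc u) f eq =
    cong₂ _+_ (sumTo-zero u f (λ k k<u → eq k (m<n⇒m<1+n k<u))) (eq u (n<1+n u))

  sumTo-+ : ∀ u f g → sumTo u (λ k → f k + g k) ≡ sumTo u f + sumTo u g
  sumTo-+ zero    f g = refl
  sumTo-+ (suc u) f g = trans (cong (_+ (f (suc u) + g (suc u))) (sumTo-+ u f g))
                              (+-interchange (sumTo u f) (sumTo u g) (f (suc u)) (g (suc u)))

  -- diag x y a b = ∑ᵢ (x choose (a − i)) (y choose (b − i)), summed over 0 ≤ i ≤ min a b.
  diag : ℕ → ℕ → ℕ → ℕ → ℕ
  diag x y zero    b       = x choose 0 * y choose b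
  diag x y (suc a) zero    = x choose suc a * y choose 0
  diag x y (suc a) (suc b) = x choose suc a * y choose suc b + diag x y a b

  diagPredˡ : ℕ → ℕ → ℕ → ℕ → ℕ
  diagPredˡ x y zero    b = 0
  diagPredˡ x y (suc a) b = diag x y a b

  diagPredʳ : ℕ → ℕ → ℕ → ℕ → ℕ
  diagPredʳ x y a zero    = 0
  diagPredʳ x y a (suc b) = diag x y a b

  diag-zeroʳ : ∀ x y a → diag x y a 0 ≡ x choose a * y choose 0
  diag-zeroʳ x y zero    = refl
  diag-zeroʳ x y (suc a) = refl

  diag-sucʳ : ∀ x y a b → diag x y a (suc b) ≡ x choose a * y choose suc b + diagPredˡ x y a b
  diag-sucʳ x y zero    b = sym (+-identityʳ _)
  diag-sucʳ x y (suc a) b = refl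

  diag-sucˡ : ∀ x y a b → diag x y (suc a) b ≡ x choose suc a * y choose b + diagPredʳ x y a b
  diag-sucˡ x y a zero    = sym (+-identityʳ _)
  diag-sucˡ x y a (suc b) = refl

  diag-comm : ∀ x y a b → diag x y a b ≡ diag y x b a
  diag-comm x y zero    zero    = *-comm (x choose 0) (y choose 0)
  diag-comm x y zero    (suc b) = *-comm (x choose 0) (y choose suc b)
  diag-comm x y (suc a) zero    = *-comm (x choose suc a) (y choose 0)
  diag-comm x y (suc a) (suc b) = cong₂ _+_ (*-comm (x choose suc a) (y choose suc b)) (diag-comm x y a b)

  diag-pascalˡ : ∀ x y a b → diag (suc x) y a b ≡ diag x y a b + diagPredˡ x y a b
  diag-pascalˡ x y zero    b       = sym (+-identityʳ _)
  diag-pascalˡ x y (suc a) zero    = begin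
      (x choose a + x choose suc a) * y choose 0
    ≡⟨ distrib (x choose a) (x choose suc a) (y choose 0) ⟩
      x choose suc a * y choose 0 + x choose a * y choose 0
    ≡⟨ cong (x choose suc a * y choose 0 +_) (diag-zeroʳ x y a) ⟨
      x choose suc a * y choose 0 + diag x y a 0 ∎
    where
    distrib : ∀ p q r → (p + q) * r ≡ q * r + p * r
    distrib = solve-∀
  diag-pascalˡ x y (suc a) (suc b) = begin
      (x choose a + x choose suc a) * y choose suc b + diag (suc x) y a b
    ≡⟨ cong ((x choose a + x choose suc a) * y choose suc b +_) (diag-pascalˡ x y a b) ⟩
      (x choose a + x choose suc a) * y choose suc b + (diag x y a b + diagPredˡ x y a b)
    ≡⟨ regroup (x choose a) (x choose suc a) (y choose suc b) (diag x y a b) (diagPredˡ x y a b) ⟩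
      (x choose suc a * y choose suc b + diag x y a b) + (x choose a * y choose suc b + diagPredˡ x y a b)
    ≡⟨ cong (x choose suc a * y choose suc b + diag x y a b +_) (diag-sucʳ x y a b) ⟨
      (x choose suc a * y choose suc b + diag x y a b) + diag x y a (suc b) ∎
    where
    regroup : ∀ p q r s t → (p + q) * r + (s + t) ≡ (q * r + s) + (p * r + t)
    regroup = solve-∀

  diag-pascalʳ : ∀ x y a b → diag x (suc y) a b ≡ diag x y a b + diagPredʳ x y a b
  diag-pascalʳ x y a b = begin
    diag x (suc y) a b                  ≡⟨ diag-comm x (suc y) a b ⟩
    diag (suc y) x b a                  ≡⟨ diag-pascalˡ y x b a ⟩
    diag y x b a + diagPredˡ y x b a    ≡⟨ cong₂ _+_ (diag-comm y x b a) (swap b) ⟩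
    diag x y a b + diagPredʳ x y a b    ∎
    where
    swap : ∀ b → diagPredˡ y x b a ≡ diagPredʳ x y a b
    swap zero    = refl
    swap (suc b) = diag-comm y x b a

  vandermonde : ∀ x y a → diag x y a y ≡ (x + y) choose a
  vandermonde x zero    a = begin
    diag x 0 a 0          ≡⟨ diag-zeroʳ x 0 a ⟩
    x choose a * 1        ≡⟨ *-identityʳ (x choose a) ⟩
    x choose a            ≡⟨ cong (_choose a) (+-identityʳ x) ⟨
    (x + 0) choose a      ∎
  vandermonde x (suc y) a = begin
      diag x (suc y) a (suc y)
    ≡⟨ diag-pascalʳ x y a (suc y) ⟩
      diag x y a (suc y) + diag x y a y
    ≡⟨ cong₂ _+_ (diag-sucʳ x y a y) (vandermonde x y a) ⟩
      x choose a * y choose suc y + diagPredˡ x y a y + (x + y) choose a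
    ≡⟨ cong (λ z → x choose a * z + diagPredˡ x y a y + (x + y) choose a) (choose-< (n<1+n y)) ⟩
      x choose a * 0 + diagPredˡ x y a y + (x + y) choose a
    ≡⟨ cong (λ z → z + diagPredˡ x y a y + (x + y) choose a) (*-zeroʳ (x choose a)) ⟩
      diagPredˡ x y a y + (x + y) choose a
    ≡⟨ cong (_+ (x + y) choose a) (lower a) ⟩
      chooseDiff (x + y) a 1 + (x + y) choose a
    ≡⟨ choose-pascal (x + y) a ⟨
      suc (x + y) choose a
    ≡⟨ cong (_choose a) (+-suc x y) ⟨
      (x + suc y) choose a ∎
    where
    lower : ∀ a → diagPredˡ x y a y ≡ chooseDiff (x + y) a 1
    lower zero    = refl
    lower (suc a) = vandermonde x y a

  -- Vandermonde's sum ∑ⱼ C(x, a − j) C(y, β + 1 + j) split at j = 0: by symmetry the part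
  -- j ≥ 0 is diag x y a b and the part j < 0 is diag y x β α.
  vandermonde-split : ∀ a α {x} → x ≡ a + suc α → ∀ β b {y} → y ≡ b + suc β →
                      (x + y) choose (a + suc β) ≡ diag x y a b + diag y x β α
  vandermonde-split a α {x} x≡ zero zero refl = begin
      (x + 1) choose (a + 1)
    ≡⟨ cong₂ _choose_ (+-comm x 1) (+-comm a 1) ⟩
      x choose a + x choose suc a
    ≡⟨ cong₂ _+_ (*-identityʳ (x choose a)) (sym (choose-sym′ (suc a) α (trans x≡ (+-suc a α)))) ⟨
      x choose a * 1 + x choose α
    ≡⟨ cong₂ _+_ (diag-zeroʳ x 1 a) (+-identityʳ (x choose α)) ⟨
      diag x 1 a 0 + diag 1 x 0 α ∎
  vandermonde-split a α {x} x≡ zero (suc b) refl = begin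
      (x + suc y) choose (a + 1)
    ≡⟨ cong₂ _choose_ (+-suc x y) (+-comm a 1) ⟩
      (x + y) choose a + (x + y) choose suc a
    ≡⟨ cong₂ _+_ (sym (trans (cong (diag x y a) (+-comm 1 b)) (vandermonde x y a)))
                 (trans (cong ((x + y) choose_) (+-comm 1 a)) (vandermonde-split a α x≡ zero b refl)) ⟩
      diag x y a (suc b) + (diag x y a b + diag y x 0 α)
    ≡⟨ +-assoc (diag x y a (suc b)) (diag x y a b) (diag y x 0 α) ⟨
      diag x y a (suc b) + diag x y a b + diag y x 0 α
    ≡⟨ cong (_+ diag y x 0 α) (diag-pascalʳ x y a (suc b)) ⟨
      diag x (suc y) a (suc b) + diag (suc y) x 0 α ∎
    where y = b + 1
  vandermonde-split a α {x} x≡ (suc β) zero refl = begin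
      (x + y) choose (a + y)
    ≡⟨ choose-sym′ (a + y) (suc α) (trans (cong (_+ y) x≡) (reorder a α y)) ⟩
      (x + y) choose suc α
    ≡⟨ vandermonde x y (suc α) ⟨
      x choose suc α * y choose y + diag x y α (suc β)
    ≡⟨ cong₂ (λ u v → u * v + diag x y α (suc β)) (choose-sym′ a (suc α) x≡) (sym (choose-self y)) ⟨
      x choose a * 1 + diag x y α (suc β)
    ≡⟨ cong₂ _+_ (diag-zeroʳ x y a) (diag-comm y x (suc β) α) ⟨
      diag x y a 0 + diag y x (suc β) α ∎
    where
    y = suc (suc β)
    reorder : ∀ a α y → a + suc α + y ≡ a + y + suc α
    reorder = solve-∀
  vandermonde-split a α {x} x≡ (suc β) (suc b) refl = begin
      (x + suc y) choose (a + suc (suc β))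
    ≡⟨ cong₂ _choose_ (+-suc x y) (+-suc a (suc β)) ⟩
      (x + y) choose (a + suc β) + (x + y) choose suc (a + suc β)
    ≡⟨ cong₂ _+_ (vandermonde-split a α x≡ β (suc b) (+-suc b (suc β)))
                 (trans (cong ((x + y) choose_) (sym (+-suc a (suc β))))
                        (vandermonde-split a α x≡ (suc β) b refl)) ⟩
      (diag x y a (suc b) + diag y x β α) + (diag x y a b + diag y x (suc β) α)
    ≡⟨ regroup (diag x y a (suc b)) (diag y x β α) (diag x y a b) (diag y x (suc β) α) ⟩
      (diag x y a (suc b) + diag x y a b) + (diag y x (suc β) α + diag y x β α)
    ≡⟨ cong₂ _+_ (diag-pascalʳ x y a (suc b)) (diag-pascalˡ y x (suc β) α) ⟨
      diag x (suc y) a (suc b) + diag (suc y) x (suc β) α ∎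
    where
    y = b + suc (suc β)
    regroup : ∀ p q r s → (p + q) + (r + s) ≡ (p + r) + (s + q)
    regroup = solve-∀

  diag-hook : ∀ x p q → diag x (suc x) p q + diag (suc x) x p q ≡
                        x choose p * x choose q + diag (suc x) (suc x) p q
  diag-hook x p q = begin
      diag x (suc x) p q + diag (suc x) x p q
    ≡⟨ cong₂ _+_ (diag-pascalʳ x x p q) (diag-pascalˡ x x p q) ⟩
      (D + diagPredʳ x x p q) + (D + diagPredˡ x x p q)
    ≡⟨ cong (D + diagPredʳ x x p q +_) (corner p) ⟩
      (D + diagPredʳ x x p q) + (x choose p * x choose q + diagPredˡ x (suc x) p q)
    ≡⟨ +-comm-middle (D + diagPredʳ x x p q) (x choose p * x choose q) (diagPredˡ x (suc x) p q) ⟩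
      x choose p * x choose q + ((D + diagPredʳ x x p q) + diagPredˡ x (suc x) p q)
    ≡⟨ cong (λ z → x choose p * x choose q + (z + diagPredˡ x (suc x) p q)) (diag-pascalʳ x x p q) ⟨
      x choose p * x choose q + (diag x (suc x) p q + diagPredˡ x (suc x) p q)
    ≡⟨ cong (x choose p * x choose q +_) (diag-pascalˡ x (suc x) p q) ⟨
      x choose p * x choose q + diag (suc x) (suc x) p q ∎
    where
    D = diag x x p q
    +-comm-middle : ∀ a b c → a + (b + c) ≡ b + (a + c)
    +-comm-middle = solve-∀
    corner : ∀ p → diag x x p q + diagPredˡ x x p q ≡ x choose p * x choose q + diagPredˡ x (suc x) p q
    corner zero    = refl
    corner (suc p) = begin
        diag x x (suc p) q + diag x x p q
      ≡⟨ cong (_+ diag x x p q) (diag-sucˡ x x p q) ⟩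
        (x choose suc p * x choose q + diagPredʳ x x p q) + diag x x p q
      ≡⟨ swap (x choose suc p * x choose q) (diagPredʳ x x p q) (diag x x p q) ⟩
        x choose suc p * x choose q + (diag x x p q + diagPredʳ x x p q)
      ≡⟨ cong (x choose suc p * x choose q +_) (diag-pascalʳ x x p q) ⟨
        x choose suc p * x choose q + diag x (suc x) p q ∎
      where
      swap : ∀ a b c → (a + b) + c ≡ a + (c + b)
      swap = solve-∀

  convolution : (ℕ → ℕ) → (ℕ → ℕ) → ℕ → ℕ
  convolution f g zero    = f 0 * g 0
  convolution f g (suc q) = f 0 * g (suc q) + convolution (λ i → f (suc i)) g q

  convolution-congˡ : ∀ {f f′} g → (∀ i → f i ≡ f′ i) → ∀ q → convolution f g q ≡ convolution f′ g q
  convolution-congˡ g f≗f′ zero    = cong (_* g 0) (f≗f′ 0)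
  convolution-congˡ g f≗f′ (suc q) =
    cong₂ _+_ (cong (_* g (suc q)) (f≗f′ 0)) (convolution-congˡ g (λ i → f≗f′ (suc i)) q)

  sumTo-convolution : ∀ q f g {h} → (∀ j → j ≤ q → h (suc j) ≡ f j * g (q ∸ j)) →
                      sumTo (suc q) h ≡ convolution f g q
  sumTo-convolution zero    f g eq = eq 0 z≤n
  sumTo-convolution (suc q) f g {h} eq = begin
      sumTo (suc (suc q)) h
    ≡⟨ sumTo-peel (suc q) h ⟩
      h 1 + sumTo (suc q) (λ k → h (suc k))
    ≡⟨ cong₂ _+_ (eq 0 z≤n) (sumTo-convolution q (λ i → f (suc i)) g (λ j j≤q → eq (suc j) (s≤s j≤q))) ⟩
      f 0 * g (suc q) + convolution (λ i → f (suc i)) g q ∎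

  convolution-partialSums : ∀ {g h} → h 0 ≡ g 0 → (∀ j → h (suc j) ≡ g (suc j) + h j) →
                            ∀ f q → convolution f h (suc q) ≡ convolution f g (suc q) + convolution f h q
  convolution-partialSums {g} {h} h₀ hₛ f zero = begin
      f 0 * h 1 + f 1 * h 0
    ≡⟨ cong₂ (λ u v → f 0 * u + f 1 * v) (hₛ 0) h₀ ⟩
      f 0 * (g 1 + h 0) + f 1 * g 0
    ≡⟨ regroup (f 0) (g 1) (h 0) (f 1 * g 0) ⟩
      (f 0 * g 1 + f 1 * g 0) + f 0 * h 0 ∎
    where
    regroup : ∀ a b c d → a * (b + c) + d ≡ (a * b + d) + a * c
    regroup = solve-∀
  convolution-partialSums {g} {h} h₀ hₛ f (suc q) = begin
      f 0 * h (suc (suc q)) + convolution f′ h (suc q)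
    ≡⟨ cong₂ (λ u v → f 0 * u + v) (hₛ (suc q)) (convolution-partialSums h₀ hₛ f′ q) ⟩
      f 0 * (g (suc (suc q)) + h (suc q)) + (convolution f′ g (suc q) + convolution f′ h q)
    ≡⟨ regroup (f 0) (g (suc (suc q))) (h (suc q)) (convolution f′ g (suc q)) (convolution f′ h q) ⟩
      (f 0 * g (suc (suc q)) + convolution f′ g (suc q)) + (f 0 * h (suc q) + convolution f′ h q) ∎
    where
    f′ = λ i → f (suc i)
    regroup : ∀ a b c d e → a * (b + c) + (d + e) ≡ (a * b + d) + (a * c + e)
    regroup = solve-∀

  upperConvolution : ∀ d q X p → convolution (λ i → (X + i) choose p) (λ j → (d + j) choose j) q ≡
                                 diag X (suc (q + d)) p q
  upperConvolution zero zero X p = begin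
    (X + 0) choose p * 1    ≡⟨ cong (λ z → z choose p * 1) (+-identityʳ X) ⟩
    X choose p * 1          ≡⟨ diag-zeroʳ X 1 p ⟨
    diag X 1 p 0            ∎
  upperConvolution zero (suc q) X p = begin
      (X + 0) choose p * suc q choose suc q + convolution (λ i → (X + suc i) choose p) (λ j → j choose j) q
    ≡⟨ cong₂ _+_ (cong₂ (λ u v → u choose p * v) (+-identityʳ X) (choose-self (suc q)))
                 (convolution-congˡ (λ j → j choose j) (λ i → cong (_choose p) (+-suc X i)) q) ⟩
      X choose p * 1 + convolution (λ i → (suc X + i) choose p) (λ j → j choose j) q
    ≡⟨ cong (X choose p * 1 +_) (upperConvolution zero q (suc X) p) ⟩
      X choose p * 1 + diag (suc X) y p q
    ≡⟨ cong (X choose p * 1 +_) (diag-pascalˡ X y p q) ⟩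
      X choose p * 1 + (diag X y p q + diagPredˡ X y p q)
    ≡⟨ rotate (X choose p * 1) (diag X y p q) (diagPredˡ X y p q) ⟩
      (X choose p * 1 + diagPredˡ X y p q) + diag X y p q
    ≡⟨ cong (λ z → (X choose p * z + diagPredˡ X y p q) + diag X y p q) y-choose-suc-q ⟨
      (X choose p * y choose suc q + diagPredˡ X y p q) + diag X y p q
    ≡⟨ cong (_+ diag X y p q) (diag-sucʳ X y p q) ⟨
      diag X y p (suc q) + diag X y p q
    ≡⟨ diag-pascalʳ X y p (suc q) ⟨
      diag X (suc y) p (suc q) ∎
    where
    y = suc (q + 0)
    y-choose-suc-q : y choose suc q ≡ 1
    y-choose-suc-q = trans (cong (λ w → suc w choose suc q) (+-identityʳ q)) (choose-self (suc q))
    rotate : ∀ a b c → a + (b + c) ≡ (a + c) + b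
    rotate = solve-∀
  upperConvolution (suc d) zero X p = begin
    (X + 0) choose p * 1         ≡⟨ cong (λ z → z choose p * 1) (+-identityʳ X) ⟩
    X choose p * 1               ≡⟨ diag-zeroʳ X _ p ⟨
    diag X (suc (suc d)) p 0     ∎
  upperConvolution (suc d) (suc q) X p = begin
      convolution f (λ j → (suc d + j) choose j) (suc q)
    ≡⟨ convolution-partialSums refl hockeyStick f q ⟩
      convolution f (λ j → (d + j) choose j) (suc q) + convolution f (λ j → (suc d + j) choose j) q
    ≡⟨ cong₂ _+_ (upperConvolution d (suc q) X p) (upperConvolution (suc d) q X p) ⟩
      diag X (suc (suc q + d)) p (suc q) + diag X y p q
    ≡⟨ cong (λ z → diag X (suc z) p (suc q) + diag X y p q) (+-suc q d) ⟨
      diag X y p (suc q) + diag X y p q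
    ≡⟨ diag-pascalʳ X y p (suc q) ⟨
      diag X (suc y) p (suc q) ∎
    where
    f = λ i → (X + i) choose p
    y = suc (q + suc d)
    hockeyStick : ∀ j → (suc d + suc j) choose suc j ≡ (d + suc j) choose suc j + (suc d + j) choose j
    hockeyStick j = trans (+-comm ((d + suc j) choose j) ((d + suc j) choose suc j))
                          (cong (λ z → (d + suc j) choose suc j + z choose j) (+-suc d j))

  summand : ℕ → ℕ → ℕ → ℕ → ℕ → ℕ
  summand m n r a b = chooseDiff (m + n + b ∸ a ∸ 1) m (r + a) * chooseDiff (m + n + a ∸ b ∸ 1) n (r + b)

  lhsSum : ℕ → ℕ → ℕ → ℕ
  lhsSum m n r = sumTo (m ∸ r) (λ a → sumTo (n ∸ r) (summand m n r a))

  summand-shift : ∀ m n r a b → summand m n r (suc a) (suc b) ≡ summand m n (suc r) a b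
  summand-shift m n r a b = cong₂ _*_
    (cong₂ (λ u v → chooseDiff (u ∸ suc a ∸ 1) m v) (+-suc (m + n) b) (+-suc r a))
    (cong₂ (λ u v → chooseDiff (u ∸ suc b ∸ 1) n v) (+-suc (m + n) a) (+-suc r b))

  summand-comm : ∀ m n r a b → summand m n r a b ≡ summand n m r b a
  summand-comm m n r a b = trans
    (*-comm (chooseDiff (m + n + b ∸ a ∸ 1) m (r + a)) (chooseDiff (m + n + a ∸ b ∸ 1) n (r + b)))
    (cong₂ _*_ (cong (λ u → chooseDiff (u + a ∸ b ∸ 1) n (r + b)) (+-comm m n))
               (cong (λ u → chooseDiff (u + b ∸ a ∸ 1) m (r + a)) (+-comm m n)))

  firstRow : ∀ r p q → sumTo (suc q) (summand (r + suc p) (r + suc q) r 1) ≡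
                       diag (r + suc p + r + q) (suc (r + suc p + r + q)) p q
  firstRow r p q = begin
      sumTo (suc q) (summand m n r 1)
    ≡⟨ sumTo-convolution q (λ i → (M + i) choose p) (λ j → (d + j) choose j) factor ⟩
      convolution (λ i → (M + i) choose p) (λ j → (d + j) choose j) q
    ≡⟨ upperConvolution d q M p ⟩
      diag M (suc (q + d)) p q
    ≡⟨ cong (λ z → diag M (suc z) p q) (+-comm q d) ⟩
      diag M (suc M) p q ∎
    where
    m = r + suc p
    n = r + suc q
    d = m + r
    M = d + q
    upper₁ : ∀ j → m + n + suc j ∸ 1 ∸ 1 ≡ M + j
    upper₁ j = cong (λ u → u ∸ 1 ∸ 1) (shape r p q j)
      where
      shape : ∀ r p q j → r + suc p + (r + suc q) + suc j ≡ suc (suc (r + suc p + r + q + j))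
      shape = solve-∀
    upper₂ : ∀ j → j ≤ q → m + n + 1 ∸ suc j ∸ 1 ≡ d + (q ∸ j)
    upper₂ j j≤q = begin
        m + n + 1 ∸ suc j ∸ 1    ≡⟨ cong (λ u → u ∸ suc j ∸ 1) (shape r p q) ⟩
        suc (suc M) ∸ suc j ∸ 1  ≡⟨ ∸-+-assoc (suc M) j 1 ⟩
        suc M ∸ (j + 1)          ≡⟨ cong (suc M ∸_) (+-comm j 1) ⟩
        M ∸ j                    ≡⟨ +-∸-assoc d j≤q ⟩
        d + (q ∸ j)              ∎
      where
      shape : ∀ r p q → r + suc p + (r + suc q) + 1 ≡ suc (suc (r + suc p + r + q))
      shape = solve-∀
    factor : ∀ j → j ≤ q → summand m n r 1 (suc j) ≡ (M + j) choose p * (d + (q ∸ j)) choose (q ∸ j)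
    factor j j≤q = cong₂ _*_
      (begin
         chooseDiff (m + n + suc j ∸ 1 ∸ 1) m (r + 1)   ≡⟨ cong (λ u → chooseDiff u m (r + 1)) (upper₁ j) ⟩
         chooseDiff (M + j) (r + suc p) (r + 1)         ≡⟨ chooseDiff-shift r (M + j) (suc p) 1 ⟩
         (M + j) choose p                                ∎)
      (begin
         chooseDiff (m + n + 1 ∸ suc j ∸ 1) n (r + suc j)   ≡⟨ cong (λ u → chooseDiff u n (r + suc j)) (upper₂ j j≤q) ⟩
         chooseDiff (d + (q ∸ j)) (r + suc q) (r + suc j)   ≡⟨ chooseDiff-shift r _ (suc q) (suc j) ⟩
         chooseDiff (d + (q ∸ j)) q j                       ≡⟨ chooseDiff-≤ _ j≤q ⟩
         (d + (q ∸ j)) choose (q ∸ j)                       ∎)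

  firstColumn : ∀ r p q → sumTo (suc p) (λ a → summand (r + suc p) (r + suc q) r a 1) ≡
                          diag (r + suc p + r + q) (suc (r + suc p + r + q)) q p
  firstColumn r p q = begin
      sumTo (suc p) (λ a → summand (r + suc p) (r + suc q) r a 1)
    ≡⟨ sumTo-cong (suc p) (λ k _ → summand-comm (r + suc p) (r + suc q) r (suc k) 1) ⟩
      sumTo (suc p) (summand (r + suc q) (r + suc p) r 1)
    ≡⟨ firstRow r q p ⟩
      diag (r + suc q + r + p) (suc (r + suc q + r + p)) q p
    ≡⟨ cong (λ z → diag z (suc z) q p) (shape r p q) ⟩
      diag (r + suc p + r + q) (suc (r + suc p + r + q)) q p ∎
    where
    shape : ∀ r p q → r + suc q + r + p ≡ r + suc p + r + q
    shape = solve-∀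

  lhsSum-peel : ∀ r p q →
    lhsSum (r + suc p) (r + suc q) r + summand (r + suc p) (r + suc q) r 1 1 ≡
    sumTo (suc q) (summand (r + suc p) (r + suc q) r 1)
      + sumTo (suc p) (λ a → summand (r + suc p) (r + suc q) r a 1)
      + lhsSum (r + suc p) (r + suc q) (suc r)
  lhsSum-peel r p q = begin
      lhsSum m n r + F 1 1
    ≡⟨ cong₂ (λ u v → sumTo u (λ a → sumTo v (F a)) + F 1 1) (m+n∸m≡n r (suc p)) (m+n∸m≡n r (suc q)) ⟩
      sumTo (suc p) (λ a → sumTo (suc q) (F a)) + F 1 1
    ≡⟨ cong (_+ F 1 1) (sumTo-peel p (λ a → sumTo (suc q) (F a))) ⟩
      row + sumTo p (λ a → sumTo (suc q) (F (suc a))) + F 1 1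
    ≡⟨ cong (λ z → row + z + F 1 1) (sumTo-cong p (λ a _ → peelInner (suc a))) ⟩
      row + sumTo p (λ a → F (suc a) 1 + sumTo q (F′ a)) + F 1 1
    ≡⟨ cong (λ z → row + z + F 1 1) (sumTo-+ p (λ a → F (suc a) 1) (λ a → sumTo q (F′ a))) ⟩
      row + (columnTail + rest) + F 1 1
    ≡⟨ regroup row columnTail rest (F 1 1) ⟩
      row + (F 1 1 + columnTail) + rest
    ≡⟨ cong₂ (λ u v → row + u + v) (sumTo-peel p (λ a → F a 1)) restIsNext ⟨
      row + sumTo (suc p) (λ a → F a 1) + lhsSum m n (suc r) ∎
    where
    m = r + suc p
    n = r + suc q
    F = summand m n r
    F′ = summand m n (suc r)
    row = sumTo (suc q) (F 1)
    columnTail = sumTo p (λ a → F (suc a) 1)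
    rest = sumTo p (λ a → sumTo q (F′ a))
    peelInner : ∀ a → sumTo (suc q) (F (suc a)) ≡ F (suc a) 1 + sumTo q (F′ a)
    peelInner a = trans (sumTo-peel q (F (suc a)))
                        (cong (F (suc a) 1 +_) (sumTo-cong q (λ b _ → summand-shift m n r a (suc b))))
    restIsNext : lhsSum m n (suc r) ≡ rest
    restIsNext = cong₂ (λ u v → sumTo u (λ a → sumTo v (F′ a)))
      (trans (cong (_∸ suc r) (+-suc r p)) (m+n∸m≡n r p))
      (trans (cong (_∸ suc r) (+-suc r q)) (m+n∸m≡n r q))
    regroup : ∀ a b c d → a + (b + c) + d ≡ a + (d + b) + c
    regroup = solve-∀

  lhsSum-step : ∀ r p q → lhsSum (r + suc p) (r + suc q) r ≡
                diag (r + suc p + (r + suc q)) (r + suc p + (r + suc q)) p q + lhsSum (r + suc p) (r + suc q) (suc r)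
  lhsSum-step r p q = +-cancelʳ-≡ _ _ _ (begin
      lhsSum m n r + F 1 1
    ≡⟨ lhsSum-peel r p q ⟩
      sumTo (suc q) (F 1) + sumTo (suc p) (λ a → F a 1) + next
    ≡⟨ cong₂ (λ u v → u + v + next) (firstRow r p q) (firstColumn r p q) ⟩
      diag M (suc M) p q + diag M (suc M) q p + next
    ≡⟨ cong (λ z → diag M (suc M) p q + z + next) (diag-comm M (suc M) q p) ⟩
      diag M (suc M) p q + diag (suc M) M p q + next
    ≡⟨ cong (_+ next) (diag-hook M p q) ⟩
      M choose p * M choose q + diag (suc M) (suc M) p q + next
    ≡⟨ rotate (M choose p * M choose q) (diag (suc M) (suc M) p q) next ⟩
      diag (suc M) (suc M) p q + next + M choose p * M choose q
    ≡⟨ cong₂ (λ u v → diag u u p q + next + v) m+n≡1+M corner ⟨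
      diag (m + n) (m + n) p q + next + F 1 1 ∎)
    where
    m = r + suc p
    n = r + suc q
    M = m + r + q
    F = summand m n r
    next = lhsSum m n (suc r)
    m+n≡1+M : m + n ≡ suc M
    m+n≡1+M = shape r p q
      where
      shape : ∀ r p q → r + suc p + (r + suc q) ≡ suc (r + suc p + r + q)
      shape = solve-∀
    upper : m + n + 1 ∸ 1 ∸ 1 ≡ M
    upper = cong (λ u → u ∸ 1 ∸ 1) (trans (+-comm (m + n) 1) (cong suc m+n≡1+M))
    corner : F 1 1 ≡ M choose p * M choose q
    corner = cong₂ _*_
      (trans (cong (λ u → chooseDiff u m (r + 1)) upper) (chooseDiff-shift r M (suc p) 1))
      (trans (cong (λ u → chooseDiff u n (r + 1)) upper) (chooseDiff-shift r M (suc q) 1))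
    rotate : ∀ a b c → a + b + c ≡ b + c + a
    rotate = solve-∀

  -- weightedDiag N c a b = ∑ᵢ (c + i) (N choose (a − i)) (N choose (b − i))
  weightedDiag : ℕ → ℕ → ℕ → ℕ → ℕ
  weightedDiag N c zero    b       = c * (N choose 0 * N choose b)
  weightedDiag N c (suc a) zero    = c * (N choose suc a * N choose 0)
  weightedDiag N c (suc a) (suc b) = c * (N choose suc a * N choose suc b) + weightedDiag N (suc c) a b

  weightedDiag-suc : ∀ N c a b → weightedDiag N (suc c) a b ≡ diag N N a b + weightedDiag N c a b
  weightedDiag-suc N c zero    b       = refl
  weightedDiag-suc N c (suc a) zero    = refl
  weightedDiag-suc N c (suc a) (suc b) = begin
      (P + c * P) + weightedDiag N (suc (suc c)) a b
    ≡⟨ cong (P + c * P +_) (weightedDiag-suc N (suc c) a b) ⟩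
      (P + c * P) + (diag N N a b + weightedDiag N (suc c) a b)
    ≡⟨ +-interchange P (c * P) (diag N N a b) (weightedDiag N (suc c) a b) ⟩
      (P + diag N N a b) + (c * P + weightedDiag N (suc c) a b) ∎
    where
    P = N choose suc a * N choose suc b

  lhsSum-≤ˡ : ∀ {m} n {r} → m ≤ r → lhsSum m n r ≡ 0
  lhsSum-≤ˡ {m} n {r} m≤r = cong (λ u → sumTo u (λ a → sumTo (n ∸ r) (summand m n r a))) (m≤n⇒m∸n≡0 m≤r)

  lhsSum-≤ʳ : ∀ m {n r} → n ≤ r → lhsSum m n r ≡ 0
  lhsSum-≤ʳ m {n} {r} n≤r = sumTo-zero (m ∸ r) (λ a → sumTo (n ∸ r) (summand m n r a))
    (λ a _ → cong (λ u → sumTo u (summand m n r (suc a))) (m≤n⇒m∸n≡0 n≤r))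

  lhsSum≡weightedDiag : ∀ p q r {m n} → m ≡ r + suc p → n ≡ r + suc q → lhsSum m n r ≡ weightedDiag (m + n) 1 p q
  lhsSum≡weightedDiag zero q r refl refl = begin
      lhsSum m n r
    ≡⟨ lhsSum-step r 0 q ⟩
      diag (m + n) (m + n) 0 q + lhsSum m n (suc r)
    ≡⟨ cong (diag (m + n) (m + n) 0 q +_) (lhsSum-≤ˡ n (≤-reflexive (+-comm r 1))) ⟩
      diag (m + n) (m + n) 0 q + 0 ∎
    where
    m = r + 1
    n = r + suc q
  lhsSum≡weightedDiag (suc p) zero r refl refl = begin
      lhsSum m n r
    ≡⟨ lhsSum-step r (suc p) 0 ⟩
      diag (m + n) (m + n) (suc p) 0 + lhsSum m n (suc r)
    ≡⟨ cong (diag (m + n) (m + n) (suc p) 0 +_) (lhsSum-≤ʳ m (≤-reflexive (+-comm r 1))) ⟩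
      diag (m + n) (m + n) (suc p) 0 + 0 ∎
    where
    m = r + suc (suc p)
    n = r + 1
  lhsSum≡weightedDiag (suc p) (suc q) r refl refl = begin
      lhsSum m n r
    ≡⟨ lhsSum-step r (suc p) (suc q) ⟩
      diag N N (suc p) (suc q) + lhsSum m n (suc r)
    ≡⟨ cong (diag N N (suc p) (suc q) +_) (lhsSum≡weightedDiag p q (suc r) (+-suc r (suc p)) (+-suc r (suc q))) ⟩
      (P + diag N N p q) + weightedDiag N 1 p q
    ≡⟨ +-assoc P (diag N N p q) (weightedDiag N 1 p q) ⟩
      P + (diag N N p q + weightedDiag N 1 p q)
    ≡⟨ cong₂ _+_ (+-identityʳ P) (weightedDiag-suc N 1 p q) ⟨
      (P + 0) + weightedDiag N 2 p q ∎
    where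
    m = r + suc (suc p)
    n = r + suc (suc q)
    N = m + n
    P = N choose suc p * N choose suc q

  -- weightedTail N r a b = ∑_{i ≥ r} (i − r + 1) (N choose (a − i)) (N choose (b − i))
  weightedTail : ℕ → ℕ → ℕ → ℕ → ℕ
  weightedTail N zero    a       b       = weightedDiag N 1 a b
  weightedTail N (suc r) zero    b       = 0
  weightedTail N (suc r) (suc a) zero    = 0
  weightedTail N (suc r) (suc a) (suc b) = weightedTail N r a b

  weightedTail-shift : ∀ N r p q → weightedTail N r (r + p) (r + q) ≡ weightedDiag N 1 p q
  weightedTail-shift N zero    p q = refl
  weightedTail-shift N (suc r) p q = weightedTail-shift N r p q

  weightedTail-<ˡ : ∀ N {r a} b → a < r → weightedTail N r a b ≡ 0
  weightedTail-<ˡ N {suc r} {zero}  b       _         = refl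
  weightedTail-<ˡ N {suc r} {suc a} zero    _         = refl
  weightedTail-<ˡ N {suc r} {suc a} (suc b) (s≤s a<r) = weightedTail-<ˡ N b a<r

  weightedTail-<ʳ : ∀ N {r} a {b} → b < r → weightedTail N r a b ≡ 0
  weightedTail-<ʳ N {suc r} zero    {b}     _         = refl
  weightedTail-<ʳ N {suc r} (suc a) {zero}  _         = refl
  weightedTail-<ʳ N {suc r} (suc a) {suc b} (s≤s b<r) = weightedTail-<ʳ N a b<r

  lhsSum≡weightedTail : ∀ m n r → lhsSum (suc m) (suc n) r ≡ weightedTail (suc m + suc n) r m n
  lhsSum≡weightedTail m n r with r ≤? m | r ≤? n
  ... | yes r≤m | yes r≤n = begin
      lhsSum (suc m) (suc n) r
    ≡⟨ lhsSum≡weightedDiag (m ∸ r) (n ∸ r) r (shape r≤m) (shape r≤n) ⟩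
      weightedDiag N 1 (m ∸ r) (n ∸ r)
    ≡⟨ weightedTail-shift N r (m ∸ r) (n ∸ r) ⟨
      weightedTail N r (r + (m ∸ r)) (r + (n ∸ r))
    ≡⟨ cong₂ (weightedTail N r) (m+[n∸m]≡n r≤m) (m+[n∸m]≡n r≤n) ⟩
      weightedTail N r m n ∎
    where
    N = suc m + suc n
    shape : ∀ {k} → r ≤ k → suc k ≡ r + suc (k ∸ r)
    shape {k} r≤k = trans (cong suc (sym (m+[n∸m]≡n r≤k))) (sym (+-suc r (k ∸ r)))
  ... | no r≰m | _       = trans (lhsSum-≤ˡ (suc n) (≰⇒> r≰m)) (sym (weightedTail-<ˡ _ n (≰⇒> r≰m)))
  ... | yes _ | no r≰n   = trans (lhsSum-≤ʳ (suc m) (≰⇒> r≰n)) (sym (weightedTail-<ʳ _ m (≰⇒> r≰n)))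

  rhsSum : ℕ → ℕ → ℕ → ℕ → ℕ
  rhsSum N r a b = sumTo (r ∸ 1) (λ k → (r ∸ k) * (chooseDiff N (suc a) k * chooseDiff N (suc b) k))

  sumTo-firstOnly : ∀ r (Q : ℕ → ℕ) → (∀ k → Q (suc (suc k)) ≡ 0) → sumTo r (λ k → (suc r ∸ k) * Q k) ≡ r * Q 1
  sumTo-firstOnly zero    Q _     = refl
  sumTo-firstOnly (suc r) Q Q≡0 = begin
      sumTo (suc r) (λ k → (suc (suc r) ∸ k) * Q k)
    ≡⟨ sumTo-peel r (λ k → (suc (suc r) ∸ k) * Q k) ⟩
      suc r * Q 1 + sumTo r (λ k → (suc r ∸ k) * Q (suc k))
    ≡⟨ cong (suc r * Q 1 +_) (sumTo-zero r (λ k → (suc r ∸ k) * Q (suc k)) (λ k _ → trans (cong ((r ∸ k) *_) (Q≡0 k)) (*-zeroʳ (r ∸ k)))) ⟩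
      suc r * Q 1 + 0
    ≡⟨ +-identityʳ _ ⟩
      suc r * Q 1 ∎

  rhsSum-suc : ∀ N r a b → rhsSum N (suc r) (suc a) (suc b) ≡ r * (N choose suc a * N choose suc b) + rhsSum N r a b
  rhsSum-suc N zero    a b = refl
  rhsSum-suc N (suc r) a b = sumTo-peel r (λ k → (suc (suc r) ∸ k) * (chooseDiff N (suc (suc a)) k * chooseDiff N (suc (suc b)) k))

  -- Both sides weight (N choose (a − i)) (N choose (b − i)) by max (i + 1) r.
  weightedTail-decomposition : ∀ N r a b → weightedTail N r a b + r * diag N N a b ≡ weightedDiag N 1 a b + rhsSum N r a b
  weightedTail-decomposition N zero a b = refl
  weightedTail-decomposition N (suc r) zero b = begin
      suc r * P
    ≡⟨ split r P ⟩
      (P + 0) + r * P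
    ≡⟨ cong (P + 0 +_) (sumTo-firstOnly r (λ k → chooseDiff N 1 k * chooseDiff N (suc b) k) (λ _ → refl)) ⟨
      (P + 0) + rhsSum N (suc r) 0 b ∎
    where
    P = N choose 0 * N choose b
    split : ∀ r P → suc r * P ≡ (P + 0) + r * P
    split = solve-∀
  weightedTail-decomposition N (suc r) (suc a) zero = begin
      suc r * P
    ≡⟨ split r P ⟩
      (P + 0) + r * P
    ≡⟨ cong (P + 0 +_) (sumTo-firstOnly r (λ k → chooseDiff N (suc (suc a)) k * chooseDiff N 1 k)
                                          (λ k → *-zeroʳ (chooseDiff N (suc a) (suc k)))) ⟨
      (P + 0) + rhsSum N (suc r) (suc a) 0 ∎
    where
    P = N choose suc a * N choose 0
    split : ∀ r P → suc r * P ≡ (P + 0) + r * P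
    split = solve-∀
  weightedTail-decomposition N (suc r) (suc a) (suc b) = begin
      weightedTail N r a b + suc r * (P + D)
    ≡⟨ split (weightedTail N r a b) r P D ⟩
      (weightedTail N r a b + r * D) + (P + D + r * P)
    ≡⟨ cong (_+ (P + D + r * P)) (weightedTail-decomposition N r a b) ⟩
      (W + rhsSum N r a b) + (P + D + r * P)
    ≡⟨ regroup W (rhsSum N r a b) P D (r * P) ⟩
      ((P + 0) + (D + W)) + (r * P + rhsSum N r a b)
    ≡⟨ cong₂ (λ u v → (P + 0) + u + v) (weightedDiag-suc N 1 a b) (rhsSum-suc N r a b) ⟨
      ((P + 0) + weightedDiag N 2 a b) + rhsSum N (suc r) (suc a) (suc b) ∎
    where
    P = N choose suc a * N choose suc b
    D = diag N N a b
    W = weightedDiag N 1 a b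
    split : ∀ L r P g → L + suc r * (P + g) ≡ (L + r * g) + (P + g + r * P)
    split = solve-∀
    regroup : ∀ v s P g rP → (v + s) + (P + g + rP) ≡ ((P + 0) + (g + v)) + (rP + s)
    regroup = solve-∀

  choose-absorb-complement : ∀ x a k → a + k ≡ suc x → suc x * x choose a ≡ k * suc x choose a
  choose-absorb-complement x a k a+k≡ = +-cancelˡ-≡ (a * suc x choose a) _ _ (begin
      a * suc x choose a + suc x * x choose a
    ≡⟨ cong (_+ suc x * x choose a) (choose-absorb x a) ⟩
      suc x * chooseDiff x a 1 + suc x * x choose a
    ≡⟨ *-distribˡ-+ (suc x) (chooseDiff x a 1) (x choose a) ⟨
      suc x * (chooseDiff x a 1 + x choose a)
    ≡⟨ cong (suc x *_) (choose-pascal x a) ⟨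
      suc x * suc x choose a
    ≡⟨ cong (_* suc x choose a) a+k≡ ⟨
      (a + k) * suc x choose a
    ≡⟨ *-distribʳ-+ (suc x choose a) a k ⟩
      a * suc x choose a + k * suc x choose a ∎)

  closedForm-step : ∀ x a b c → a + b + 2 * c ≡ suc x →
    2 * c * (suc x choose a * suc x choose b) + suc x * (chooseDiff x a 1 * chooseDiff x b 1) ≡
    suc x * (x choose a * x choose b)
  closedForm-step x a b c a+b+2c≡ = *-cancelˡ-≡ _ _ (suc x) (begin
      N * (2 * c * (A * B) + N * (A₋ * B₋))
    ≡⟨ expand N c A B A₋ B₋ ⟩
      N * (2 * c * (A * B)) + (N * A₋) * (N * B₋)
    ≡⟨ cong₂ (λ u v → N * (2 * c * (A * B)) + u * v) (choose-absorb x a) (choose-absorb x b) ⟨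
      N * (2 * c * (A * B)) + (a * A) * (b * B)
    ≡⟨ cong (λ u → u * (2 * c * (A * B)) + (a * A) * (b * B)) a+b+2c≡ ⟨
      (a + b + 2 * c) * (2 * c * (A * B)) + (a * A) * (b * B)
    ≡⟨ factorise a b c A B ⟩
      ((b + 2 * c) * A) * ((a + 2 * c) * B)
    ≡⟨ cong₂ _*_ (choose-absorb-complement x a (b + 2 * c) (trans (sym (+-assoc a b (2 * c))) a+b+2c≡))
                 (choose-absorb-complement x b (a + 2 * c) (trans (swap b a (2 * c)) a+b+2c≡)) ⟨
      (N * x choose a) * (N * x choose b)
    ≡⟨ collect N (x choose a) (x choose b) ⟩
      N * (N * (x choose a * x choose b)) ∎)
    where
    N = suc x
    A = N choose a
    B = N choose b
    A₋ = chooseDiff x a 1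
    B₋ = chooseDiff x b 1
    expand : ∀ N c A B A₋ B₋ → N * (2 * c * (A * B) + N * (A₋ * B₋)) ≡ N * (2 * c * (A * B)) + (N * A₋) * (N * B₋)
    expand = solve-∀
    factorise : ∀ a b c A B → (a + b + 2 * c) * (2 * c * (A * B)) + (a * A) * (b * B) ≡ ((b + 2 * c) * A) * ((a + 2 * c) * B)
    factorise = solve-∀
    swap : ∀ b a k → b + (a + k) ≡ a + b + k
    swap = solve-∀
    collect : ∀ N X Y → (N * X) * (N * Y) ≡ N * (N * (X * Y))
    collect = solve-∀

  weightedDiag-closedForm : ∀ x c a b → a + b + 2 * c ≡ suc x →
                            2 * weightedDiag (suc x) c a b ≡ suc x * (x choose a * x choose b)
  weightedDiag-closedForm x c zero b eq = begin
      2 * (c * (suc x choose 0 * suc x choose b))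
    ≡⟨ addZero c (suc x choose 0 * suc x choose b) (suc x) ⟩
      2 * c * (suc x choose 0 * suc x choose b) + suc x * (0 * chooseDiff x b 1)
    ≡⟨ closedForm-step x 0 b c eq ⟩
      suc x * (x choose 0 * x choose b) ∎
    where
    addZero : ∀ c z n → 2 * (c * z) ≡ 2 * c * z + n * (0 * 0)
    addZero = solve-∀
  weightedDiag-closedForm x c (suc a) zero eq = begin
      2 * (c * (suc x choose suc a * suc x choose 0))
    ≡⟨ addZero c (suc x choose suc a * suc x choose 0) (suc x) (x choose a) ⟩
      2 * c * (suc x choose suc a * suc x choose 0) + suc x * (x choose a * 0)
    ≡⟨ closedForm-step x (suc a) 0 c eq ⟩
      suc x * (x choose suc a * x choose 0) ∎
    where
    addZero : ∀ c z n w → 2 * (c * z) ≡ 2 * c * z + n * (w * 0)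
    addZero = solve-∀
  weightedDiag-closedForm x c (suc a) (suc b) eq = begin
      2 * (c * P + weightedDiag (suc x) (suc c) a b)
    ≡⟨ *-distribˡ-+ 2 (c * P) (weightedDiag (suc x) (suc c) a b) ⟩
      2 * (c * P) + 2 * weightedDiag (suc x) (suc c) a b
    ≡⟨ cong₂ _+_ (sym (*-assoc 2 c P)) (weightedDiag-closedForm x (suc c) a b (trans (shape a b c) eq)) ⟩
      2 * c * P + suc x * (x choose a * x choose b)
    ≡⟨ closedForm-step x (suc a) (suc b) c eq ⟩
      suc x * (x choose suc a * x choose suc b) ∎
    where
    P = suc x choose suc a * suc x choose suc b
    shape : ∀ a b c → a + b + 2 * suc c ≡ suc a + suc b + 2 * c
    shape = solve-∀

  lhsSum-identity : ∀ m n r → lhsSum (suc m) (suc n) r + r * diag (suc m + suc n) (suc m + suc n) m n ≡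
                    weightedDiag (suc m + suc n) 1 m n + rhsSum (suc m + suc n) r m n
  lhsSum-identity m n r = begin
      lhsSum (suc m) (suc n) r + r * diag N N m n
    ≡⟨ cong (_+ r * diag N N m n) (lhsSum≡weightedTail m n r) ⟩
      weightedTail N r m n + r * diag N N m n
    ≡⟨ weightedTail-decomposition N r m n ⟩
      weightedDiag N 1 m n + rhsSum N r m n ∎
    where N = suc m + suc n

  weightedDiag-formula : ∀ m n → 2 * (suc m + suc n) * weightedDiag (suc m + suc n) 1 m n ≡
                         suc m * suc n * ((suc m + suc n) C suc m) ^ 2
  weightedDiag-formula m n = begin
      2 * N * weightedDiag N 1 m n
    ≡⟨ reassoc N (weightedDiag N 1 m n) ⟩
      N * (2 * weightedDiag N 1 m n)
    ≡⟨ cong (N *_) (weightedDiag-closedForm x 1 m n (shape m n)) ⟩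
      N * (N * (x choose m * x choose n))
    ≡⟨ distribute N (x choose m) (x choose n) ⟩
      (N * x choose m) * (N * x choose n)
    ≡⟨ cong₂ _*_ (choose-absorb x (suc m)) (choose-absorb x (suc n)) ⟨
      (suc m * N choose suc m) * (suc n * N choose suc n)
    ≡⟨ cong (λ z → (suc m * N choose suc m) * (suc n * z)) (choose-sym (suc m) (suc n)) ⟨
      (suc m * N choose suc m) * (suc n * N choose suc m)
    ≡⟨ collect (suc m) (suc n) (N choose suc m) ⟩
      suc m * suc n * (N choose suc m) ^ 2
    ≡⟨ cong (λ z → suc m * suc n * z ^ 2) (choose≡C N (suc m)) ⟩
      suc m * suc n * (N C suc m) ^ 2 ∎
    where
    x = m + suc n
    N = suc x
    shape : ∀ m n → m + n + 2 * 1 ≡ suc (m + suc n)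
    shape = solve-∀
    reassoc : ∀ a b → 2 * a * b ≡ a * (2 * b)
    reassoc = solve-∀
    distribute : ∀ a b c → a * (a * (b * c)) ≡ (a * b) * (a * c)
    distribute = solve-∀
    collect : ∀ a b c → (a * c) * (b * c) ≡ a * b * (c * (c * 1))
    collect = solve-∀

  doubledChoose-split : ∀ m n → (2 * suc m + 2 * suc n) C (2 * suc m) ≡
                        ((suc m + suc n) C suc m) ^ 2 + 2 * diag (suc m + suc n) (suc m + suc n) m n
  doubledChoose-split m n = begin
      (2 * suc m + 2 * suc n) C (2 * suc m)
    ≡⟨ choose≡C (2 * suc m + 2 * suc n) (2 * suc m) ⟨
      (2 * suc m + 2 * suc n) choose (2 * suc m)
    ≡⟨ cong₂ _choose_ (doubleSum (suc m) (suc n)) (double (suc m)) ⟩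
      (N + N) choose (suc m + suc m)
    ≡⟨ vandermonde-split (suc m) n refl m (suc n) (+-comm (suc m) (suc n)) ⟩
      (N choose suc m * N choose suc n + D) + D
    ≡⟨ cong (λ z → (N choose suc m * z + D) + D) (choose-sym (suc m) (suc n)) ⟨
      (N choose suc m * N choose suc m + D) + D
    ≡⟨ collect (N choose suc m) D ⟩
      (N choose suc m) ^ 2 + 2 * D
    ≡⟨ cong (λ z → z ^ 2 + 2 * D) (choose≡C N (suc m)) ⟩
      (N C suc m) ^ 2 + 2 * D ∎
    where
    N = suc m + suc n
    D = diag N N m n
    doubleSum : ∀ a b → 2 * a + 2 * b ≡ a + b + (a + b)
    doubleSum = solve-∀
    double : ∀ a → 2 * a ≡ a + a
    double = solve-∀
    collect : ∀ c d → (c * c + d) + d ≡ c * (c * 1) + 2 * d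
    collect = solve-∀

open BinomialIdentities
open import Defs
import Data.Nat as ℕ
import Data.Nat.Properties as ℕP
open import Data.Integer using (+_; _⊖_)
import Data.Integer as ℤ
import Data.Integer.Properties as ℤP
open import Data.Rational using (ℚ; _+_; _-_; _*_; ½; toℚᵘ)
import Data.Rational.Properties as ℚP
open import Data.Rational.Unnormalised using (mkℚᵘ; *≡*) renaming (_≃_ to _≃ᵘ_)
import Data.Rational.Unnormalised.Properties as ℚᵘP
open import Data.Rational.Solver using (module +-*-Solver)
open import Data.Empty using (⊥-elim-irr)

binom-⊖ : ∀ N a t → binom N (a ⊖ t) ≡ chooseDiff N a t
binom-⊖ N a       zero    = sym (choose≡C N a)
binom-⊖ N zero    (suc t) = refl
binom-⊖ N (suc a) (suc t) = trans (cong (binom N) (ℤP.[1+m]⊖[1+n]≡m⊖n a t)) (binom-⊖ N a t)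

binom-minus : ∀ N a t → binom N (+ a ℤ.- + t) ≡ chooseDiff N a t
binom-minus N a t = trans (cong (binom N) (ℤP.m-n≡m⊖n a t)) (binom-⊖ N a t)

binom-minus² : ∀ N a r t → binom N (+ a ℤ.- + r ℤ.- + t) ≡ chooseDiff N a (r ℕ.+ t)
binom-minus² N a r t = trans (cong (binom N) a-r-t≡a-[r+t]) (binom-minus N a (r ℕ.+ t))
  where
  a-r-t≡a-[r+t] : + a ℤ.- + r ℤ.- + t ≡ + a ℤ.- + (r ℕ.+ t)
  a-r-t≡a-[r+t] = trans (ℤP.+-assoc (+ a) (ℤ.- + r) (ℤ.- + t))
                        (cong (ℤ._+_ (+ a)) (sym (ℤP.neg-distrib-+ (+ r) (+ t))))

⟦⟧ᵘ : ∀ n → toℚᵘ ⟦ n ⟧ ≃ᵘ mkℚᵘ (+ n) 0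
⟦⟧ᵘ n = ℚP.toℚᵘ-fromℚᵘ (mkℚᵘ (+ n) 0)

≡-via-ℚᵘ : ∀ {x y u v} → toℚᵘ x ≃ᵘ u → toℚᵘ y ≃ᵘ v → u ≃ᵘ v → x ≡ y
≡-via-ℚᵘ x≃u y≃v u≃v = ℚP.toℚᵘ-injective (ℚᵘP.≃-trans x≃u (ℚᵘP.≃-trans u≃v (ℚᵘP.≃-sym y≃v)))

⟦⟧-+ : ∀ a b → ⟦ a ℕ.+ b ⟧ ≡ ⟦ a ⟧ + ⟦ b ⟧
⟦⟧-+ a b = ≡-via-ℚᵘ (⟦⟧ᵘ (a ℕ.+ b))
  (ℚᵘP.≃-trans (ℚP.toℚᵘ-homo-+ ⟦ a ⟧ ⟦ b ⟧) (ℚᵘP.+-cong (⟦⟧ᵘ a) (⟦⟧ᵘ b)))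
  (*≡* (cong (ℤ._* + 1) (trans (sym (ℤP.pos-+ a b))
                               (sym (cong₂ ℤ._+_ (ℤP.*-identityʳ (+ a)) (ℤP.*-identityʳ (+ b)))))))

⟦⟧-* : ∀ a b → ⟦ a ℕ.* b ⟧ ≡ ⟦ a ⟧ * ⟦ b ⟧
⟦⟧-* a b = ≡-via-ℚᵘ (⟦⟧ᵘ (a ℕ.* b))
  (ℚᵘP.≃-trans (ℚP.toℚᵘ-homo-* ⟦ a ⟧ ⟦ b ⟧) (ℚᵘP.*-cong (⟦⟧ᵘ a) (⟦⟧ᵘ b)))
  (*≡* (cong (ℤ._* + 1) (ℤP.pos-* a b)))

divℕ-* : ∀ p q .{{_ : NonZero q}} z w → q ℕ.* w ≡ p ℕ.* z → divℕ p q * ⟦ z ⟧ ≡ ⟦ w ⟧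
divℕ-* p (suc q) z w q*w≡p*z = ≡-via-ℚᵘ
  (ℚᵘP.≃-trans (ℚP.toℚᵘ-homo-* (divℕ p (suc q)) ⟦ z ⟧) (ℚᵘP.*-cong (ℚP.toℚᵘ-fromℚᵘ (mkℚᵘ (+ p) q)) (⟦⟧ᵘ z)))
  (⟦⟧ᵘ w)
  (*≡* (begin
    (+ p ℤ.* + z) ℤ.* + 1          ≡⟨ ℤP.*-identityʳ _ ⟩
    + p ℤ.* + z                    ≡⟨ ℤP.pos-* p z ⟨
    + (p ℕ.* z)                    ≡⟨ cong +_ q*w≡p*z ⟨
    + (suc q ℕ.* w)                ≡⟨ cong +_ (ℕP.*-comm (suc q) w) ⟩
    + (w ℕ.* suc q)                ≡⟨ cong (λ t → + (w ℕ.* t)) (ℕP.*-identityʳ (suc q)) ⟨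
    + (w ℕ.* (suc q ℕ.* 1))        ≡⟨ ℤP.pos-* w (suc q ℕ.* 1) ⟩
    + w ℤ.* + (suc q ℕ.* 1)        ∎))

sumFrom1-+ : ∀ u f {F} → (∀ k → F k ≡ ⟦ f k ⟧) → sumFrom1 (+ u) F ≡ ⟦ sumTo u f ⟧
sumFrom1-+ zero    f F≗ = refl
sumFrom1-+ (suc u) f F≗ = trans (cong₂ _+_ (sumFrom1-+ u f F≗) (F≗ (suc u))) (sym (⟦⟧-+ (sumTo u f) (f (suc u))))

sumFrom1-⊖ : ∀ a r f {F} → (∀ k → F k ≡ ⟦ f k ⟧) → sumFrom1 (a ⊖ r) F ≡ ⟦ sumTo (a ℕ.∸ r) f ⟧
sumFrom1-⊖ a       zero    f F≗ = sumFrom1-+ a f F≗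
sumFrom1-⊖ zero    (suc r) f F≗ = refl
sumFrom1-⊖ (suc a) (suc r) f {F} F≗ =
  trans (cong (λ u → sumFrom1 u F) (ℤP.[1+m]⊖[1+n]≡m⊖n a r)) (sumFrom1-⊖ a r f F≗)

sumFrom1-minus : ∀ a r f {F} → (∀ k → F k ≡ ⟦ f k ⟧) → sumFrom1 (+ a ℤ.- + r) F ≡ ⟦ sumTo (a ℕ.∸ r) f ⟧
sumFrom1-minus a r f {F} F≗ = trans (cong (λ u → sumFrom1 u F) (ℤP.m-n≡m⊖n a r)) (sumFrom1-⊖ a r f F≗)

lhsSum-ℚ : ∀ m n r →
  sumFrom1 (+ m ℤ.- + r) (λ a → sumFrom1 (+ n ℤ.- + r) (λ b →
    ⟦ binom (m ℕ.+ n ℕ.+ b ℕ.∸ a ℕ.∸ 1) (+ m ℤ.- + r ℤ.- + a)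
      ℕ.* binom (m ℕ.+ n ℕ.+ a ℕ.∸ b ℕ.∸ 1) (+ n ℤ.- + r ℤ.- + b) ⟧))
  ≡ ⟦ lhsSum m n r ⟧
lhsSum-ℚ m n r = sumFrom1-minus m r _ λ a → sumFrom1-minus n r _ λ b →
  cong ⟦_⟧ (cong₂ ℕ._*_ (binom-minus² _ m r a) (binom-minus² _ n r b))

rhsSum-ℚ : ∀ N r m n →
  sumFrom1 (+ r ℤ.- + 1) (λ k → ⟦ (r ℕ.∸ k) ℕ.* (binom N (+ suc m ℤ.- + k) ℕ.* binom N (+ suc n ℤ.- + k)) ⟧)
  ≡ ⟦ rhsSum N r m n ⟧
rhsSum-ℚ N r m n = sumFrom1-minus r 1 _ λ k →
  cong (λ z → ⟦ (r ℕ.∸ k) ℕ.* z ⟧) (cong₂ ℕ._*_ (binom-minus N (suc m) k) (binom-minus N (suc n) k))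

isolate : ∀ {l v s g c c′ d r : ℚ} → d * c ≡ v → c′ ≡ c + ⟦ 2 ⟧ * g → l + r * g ≡ v + s →
          l ≡ (d * c - (r * ½) * c′ + (r * ½) * c) + s
isolate {l} {v} {s} {g} {c} {c′} {d} {r} d*c≡v c′≡ l+r*g≡v+s = begin
    l
  ≡⟨ cancel l r g ⟩
    (l + r * g) - r * g
  ≡⟨ cong (_- r * g) l+r*g≡v+s ⟩
    (v + s) - r * g
  ≡⟨ rearrange v c g r s ⟩
    (v - (r * ½) * (c + ⟦ 2 ⟧ * g) + (r * ½) * c) + s
  ≡⟨ cong₂ (λ u w → (u - (r * ½) * w + (r * ½) * c) + s) d*c≡v c′≡ ⟨
    (d * c - (r * ½) * c′ + (r * ½) * c) + s ∎
  where
  open +-*-Solver using (solve; _:=_; _:+_; _:*_; _:-_; con)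
  cancel : ∀ l r g → l ≡ (l + r * g) - r * g
  cancel = solve 3 (λ l r g → l := (l :+ r :* g) :- r :* g) refl
  rearrange : ∀ v c g r s → (v + s) - r * g ≡ (v - (r * ½) * (c + ⟦ 2 ⟧ * g) + (r * ½) * c) + s
  rearrange = solve 5 (λ v c g r s → (v :+ s) :- r :* g :=
                         (v :- (r :* con ½) :* (c :+ con ⟦ 2 ⟧ :* g) :+ (r :* con ½) :* c) :+ s) refl

mainTheorem8 : (m n r : ℕ) → .{{_ : NonZero m}} → .{{_ : NonZero n}} → .{{_ : NonZero r}} →
    sumFrom1 (+ m ℤ.- + r) (λ a → sumFrom1 (+ n ℤ.- + r) (λ b →
        ⟦ binom (m ℕ.+ n ℕ.+ b ℕ.∸ a ℕ.∸ 1) (+ m ℤ.- + r ℤ.- + a)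
          ℕ.* binom (m ℕ.+ n ℕ.+ a ℕ.∸ b ℕ.∸ 1) (+ n ℤ.- + r ℤ.- + b) ⟧))
    ≡ (divℕ (m ℕ.* n) (2 ℕ.* (m ℕ.+ n)) {{nz2mn m n}} * ⟦ ((m ℕ.+ n) C m) ℕ.^ 2 ⟧
       - (⟦ r ⟧ * ½) * ⟦ (2 ℕ.* m ℕ.+ 2 ℕ.* n) C (2 ℕ.* m) ⟧
       + (⟦ r ⟧ * ½) * ⟦ ((m ℕ.+ n) C m) ℕ.^ 2 ⟧)
      + sumFrom1 (+ r ℤ.- + 1) (λ k →
          ⟦ (r ℕ.∸ k) ℕ.* (binom (m ℕ.+ n) (+ m ℤ.- + k) ℕ.* binom (m ℕ.+ n) (+ n ℤ.- + k)) ⟧)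
mainTheorem8 zero    _       _ {{m≢0}} = ⊥-elim-irr (NonZero.nonZero m≢0)
mainTheorem8 (suc m) zero    _ {{_}} {{n≢0}} = ⊥-elim-irr (NonZero.nonZero n≢0)
mainTheorem8 (suc m) (suc n) r = begin
    _                                          ≡⟨ lhsSum-ℚ (suc m) (suc n) r ⟩
    ⟦ L ⟧                                      ≡⟨ isolate {g = ⟦ D ⟧} {c = ⟦ C² ⟧} {c′ = ⟦ C′ ⟧} {d = d} {r = ⟦ r ⟧}
                                                    weightedDiag-ℚ doubledChoose-ℚ lhsSum-identity-ℚ ⟩
    (d * ⟦ C² ⟧ - ρ * ⟦ C′ ⟧ + ρ * ⟦ C² ⟧) + ⟦ S ⟧
                                               ≡⟨ cong (λ z → (d * ⟦ C² ⟧ - ρ * ⟦ C′ ⟧ + ρ * ⟦ C² ⟧) + z) (rhsSum-ℚ N r m n) ⟨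
    _                                          ∎
  where
  N = suc m ℕ.+ suc n
  L = lhsSum (suc m) (suc n) r
  S = rhsSum N r m n
  V = weightedDiag N 1 m n
  D = diag N N m n
  C² = (N C suc m) ℕ.^ 2
  C′ = (2 ℕ.* suc m ℕ.+ 2 ℕ.* suc n) C (2 ℕ.* suc m)
  d = divℕ (suc m ℕ.* suc n) (2 ℕ.* N)
  ρ = ⟦ r ⟧ * ½
  weightedDiag-ℚ : d * ⟦ C² ⟧ ≡ ⟦ V ⟧
  weightedDiag-ℚ = divℕ-* (suc m ℕ.* suc n) (2 ℕ.* N) C² V (weightedDiag-formula m n)
  doubledChoose-ℚ : ⟦ C′ ⟧ ≡ ⟦ C² ⟧ + ⟦ 2 ⟧ * ⟦ D ⟧
  doubledChoose-ℚ = trans (cong ⟦_⟧ (doubledChoose-split m n))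
                          (trans (⟦⟧-+ C² (2 ℕ.* D)) (cong (λ z → ⟦ C² ⟧ + z) (⟦⟧-* 2 D)))
  lhsSum-identity-ℚ : ⟦ L ⟧ + ⟦ r ⟧ * ⟦ D ⟧ ≡ ⟦ V ⟧ + ⟦ S ⟧
  lhsSum-identity-ℚ = begin
    ⟦ L ⟧ + ⟦ r ⟧ * ⟦ D ⟧    ≡⟨ cong (λ z → ⟦ L ⟧ + z) (⟦⟧-* r D) ⟨
    ⟦ L ⟧ + ⟦ r ℕ.* D ⟧      ≡⟨ ⟦⟧-+ L (r ℕ.* D) ⟨
    ⟦ L ℕ.+ r ℕ.* D ⟧        ≡⟨ cong ⟦_⟧ (lhsSum-identity m n r) ⟩
    ⟦ V ℕ.+ S ⟧              ≡⟨ ⟦⟧-+ V S ⟩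
    ⟦ V ⟧ + ⟦ S ⟧            ∎
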